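{- Let $X,Y,Z\in\mathbb{Z}[i]$ with $X,Z\in O^I$ and $Y=(1+i)^2W$ for some $W\in G$, and suppose $X^2+iY^2=Z^2$, $\gcd(X,Y)=1$ and $XYZ\neq0$. Then there exist an integer $t$ and $P,Q\in G$ with $\gcd(P,Q)=1$ such that $$X=i^{t+1}\bigl(P^2-(-1)^t iQ^2\bigr),\quad Y=(1+i)^2PQ,\quad Z=i^{t+1}\bigl(P^2+(-1)^t iQ^2\bigr).$$
   Context: $\mathbb{Z}[i]$ is the ring of Gaussian integers and $U=\{1,-1,i,-i\}$ its unit group. For $\alpha\in\mathbb{Z}[i]$, $R(\alpha)$ and $I(\alpha)$ denote its real and imaginary parts. $O^I=\{\alpha\in\mathbb{Z}[i]: R(\alpha)+I(\alpha)\equiv 1 \pmod 2,\ R(\alpha)\equiv 1 \pmod 4\}$. $G$ denotes the set of Gaussian integers of the form $(1+i)^{a_1}p_2^{a_2}\cdots p_m^{a_m}$ with integers $a_j\ge 0$ and $p_2,\dots,p_m$ distinct Gaussian primes belonging to $O^I$ (the empty product $1$ included). "$\gcd(a,b)=1$" means no common non-unit divisor. -}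

module Defs where

open import Data.Nat as ℕ using (ℕ; zero; suc)
open import Data.Integer as ℤ using (ℤ; +_; -[1+_])
open import Data.Integer.DivMod using (_%ℕ_)
open import Data.Product using (Σ; ∃; _×_; _,_; proj₁)
open import Data.Sum using (_⊎_)
open import Data.List using (List; []; _∷_; map)
open import Data.List.Relation.Unary.All using (All)
open import Data.List.Relation.Unary.AllPairs using (AllPairs)
open import Relation.Binary.PropositionalEquality using (_≡_; _≢_)
open import Relation.Nullary using (¬_)

record GZ : Set where
  constructor _+_i
  field
    re : ℤ
    im : ℤ
open GZ public

infixl 6 _+ᵍ_ _-ᵍ_
infixl 7 _*ᵍ_
infixr 8 _^ᵍ_

_+ᵍ_ : GZ → GZ → GZ
(a + b i) +ᵍ (c + d i) = (a ℤ.+ c) + (b ℤ.+ d) i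

-ᵍ_ : GZ → GZ
-ᵍ (a + b i) = (ℤ.- a) + (ℤ.- b) i

_-ᵍ_ : GZ → GZ → GZ
x -ᵍ y = x +ᵍ (-ᵍ y)

_*ᵍ_ : GZ → GZ → GZ
(a + b i) *ᵍ (c + d i) = (a ℤ.* c ℤ.- b ℤ.* d) + (a ℤ.* d ℤ.+ b ℤ.* c) i

0ᵍ 1ᵍ iᵍ 1+i : GZ
0ᵍ = (+ 0) + (+ 0) i
1ᵍ = (+ 1) + (+ 0) i
iᵍ = (+ 0) + (+ 1) i
1+i = (+ 1) + (+ 1) i

_^ᵍ_ : GZ → ℕ → GZ
x ^ᵍ zero = 1ᵍ
x ^ᵍ suc n = x *ᵍ (x ^ᵍ n)

-- i^t for an integer t (i has order 4, so i^t = i^(t mod 4))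
iPow : ℤ → GZ
iPow t = iᵍ ^ᵍ (t %ℕ 4)

negOnePow : ℤ → GZ
negOnePow t = (-ᵍ 1ᵍ) ^ᵍ (t %ℕ 2)

_∣ᵍ_ : GZ → GZ → Set
a ∣ᵍ b = ∃ λ c → b ≡ a *ᵍ c

IsUnit : GZ → Set
IsUnit u = u ∣ᵍ 1ᵍ

IsGaussianPrime : GZ → Set
IsGaussianPrime p =
  (p ≢ 0ᵍ) × (¬ IsUnit p) × (∀ d → d ∣ᵍ p → IsUnit d ⊎ p ∣ᵍ d)

Coprimeᵍ : GZ → GZ → Set
Coprimeᵍ a b = ∀ d → d ∣ᵍ a → d ∣ᵍ b → IsUnit d

InOI : GZ → Set
InOI α = (∃ λ m → re α ℤ.+ im α ≡ + 1 ℤ.+ + 2 ℤ.* m)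
       × (∃ λ k → re α ≡ + 1 ℤ.+ + 4 ℤ.* k)

prodPow : List (GZ × ℕ) → GZ
prodPow [] = 1ᵍ
prodPow ((p , a) ∷ ps) = (p ^ᵍ a) *ᵍ prodPow ps

InG : GZ → Set
InG α = ∃ λ (a₁ : ℕ) → ∃ λ (ps : List (GZ × ℕ)) →
          AllPairs _≢_ (map proj₁ ps)
        × All (λ pa → IsGaussianPrime (proj₁ pa) × InOI (proj₁ pa)) ps
        × α ≡ (1+i ^ᵍ a₁) *ᵍ prodPow ps

-- Write Z = X + 2D, which is possible because X ≡ Z ≡ 1 (mod 2) in O^I. The equation then
-- becomes (X + D) D = -i W², and a common divisor of X + D, D and W divides both X and Y,
-- so it is a unit. Since ℤ[i] is Euclidean, every Gaussian prime satisfies Euclid's lemma;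
-- prime by prime, the factor p^(2a) of W² therefore distributes over X + D and D as even
-- powers, giving X + D = A₀ P², D = B₀ Q² with P Q = W and A₀ B₀ = -i. Writing the unit A₀
-- as i^(t+1) yields the parametrisation, and gcd(P, Q) = 1 is inherited from gcd(X, Y) = 1.
{-# OPTIONS --safe #-}
module Submission where

open import Defs
open import Data.Integer using (ℤ; +_; _+_)
open import Data.Product using (∃; _×_)
open import Relation.Binary.PropositionalEquality using (_≡_; _≢_)

open import Level using (0ℓ)
open import Function using (_∘_)
open import Data.Nat as ℕ using (ℕ; zero; suc; _≟_)
import Data.Nat.Properties as ℕP
import Data.Nat.Divisibility as ℕ∣
open import Data.Nat.Primality using (prime?; euclidsLemma)
import Data.Nat.Tactic.RingSolver as ℕSolver
import Data.Integer as ℤ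
open import Data.Integer using (-[1+_]; ∣_∣; _⊖_)
import Data.Integer.Properties as ℤP
open import Data.Integer.DivMod using (_%ℕ_; _/ℕ_; a≡a%ℕn+[a/ℕn]*n; n%ℕd<d)
import Data.Integer.Divisibility.Signed as ℤ∣
import Data.Integer.Tactic.RingSolver as ℤSolver
open import Data.Product using (_,_; proj₁; proj₂)
open import Data.Sum as Sum using (_⊎_; inj₁; inj₂; [_,_])
open import Data.Empty using (⊥; ⊥-elim)
open import Relation.Nullary using (¬_; yes; no)
open import Relation.Nullary.Decidable using (from-yes)
open import Data.Maybe using (just; nothing)
open import Data.List using (List; []; _∷_; map)
open import Data.List.Properties using (∷-injective)
open import Data.List.Relation.Unary.All as All using (All)
open import Data.List.Relation.Unary.All.Properties using (map⁺; map⁻)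
open import Data.List.Relation.Unary.AllPairs using (AllPairs)
open import Algebra.Bundles using (CommutativeRing)
open import Algebra.Structures using (IsCommutativeRing)
import Tactic.RingSolver as Solver
import Tactic.RingSolver.Core.AlmostCommutativeRing as ACR
open import Relation.Binary.PropositionalEquality
  using (refl; sym; trans; cong; cong₂; subst; isEquivalence; module ≡-Reasoning)

-- ℤ[i] as a commutative ring

+ᵍ-comm : ∀ x y → x +ᵍ y ≡ y +ᵍ x
+ᵍ-comm (a + b i) (c + d i) = cong₂ _+_i (ℤP.+-comm a c) (ℤP.+-comm b d)

+ᵍ-assoc : ∀ x y z → (x +ᵍ y) +ᵍ z ≡ x +ᵍ (y +ᵍ z)
+ᵍ-assoc (a + b i) (c + d i) (e + f i) = cong₂ _+_i (ℤP.+-assoc a c e) (ℤP.+-assoc b d f)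

+ᵍ-identityˡ : ∀ x → 0ᵍ +ᵍ x ≡ x
+ᵍ-identityˡ (a + b i) = cong₂ _+_i (ℤP.+-identityˡ a) (ℤP.+-identityˡ b)

+ᵍ-identityʳ : ∀ x → x +ᵍ 0ᵍ ≡ x
+ᵍ-identityʳ (a + b i) = cong₂ _+_i (ℤP.+-identityʳ a) (ℤP.+-identityʳ b)

-ᵍ-inverseˡ : ∀ x → (-ᵍ x) +ᵍ x ≡ 0ᵍ
-ᵍ-inverseˡ (a + b i) = cong₂ _+_i (ℤP.+-inverseˡ a) (ℤP.+-inverseˡ b)

-ᵍ-inverseʳ : ∀ x → x +ᵍ (-ᵍ x) ≡ 0ᵍ
-ᵍ-inverseʳ (a + b i) = cong₂ _+_i (ℤP.+-inverseʳ a) (ℤP.+-inverseʳ b)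

*ᵍ-comm : ∀ x y → x *ᵍ y ≡ y *ᵍ x
*ᵍ-comm (a + b i) (c + d i) = cong₂ _+_i (re-comm a b c d) (im-comm a b c d)
  where
  re-comm : ∀ a b c d → a ℤ.* c ℤ.- b ℤ.* d ≡ c ℤ.* a ℤ.- d ℤ.* b
  re-comm = ℤSolver.solve-∀
  im-comm : ∀ a b c d → a ℤ.* d ℤ.+ b ℤ.* c ≡ c ℤ.* b ℤ.+ d ℤ.* a
  im-comm = ℤSolver.solve-∀

*ᵍ-assoc : ∀ x y z → (x *ᵍ y) *ᵍ z ≡ x *ᵍ (y *ᵍ z)
*ᵍ-assoc (a + b i) (c + d i) (e + f i) = cong₂ _+_i (re-assoc a b c d e f) (im-assoc a b c d e f)
  where
  re-assoc : ∀ a b c d e f → (a ℤ.* c ℤ.- b ℤ.* d) ℤ.* e ℤ.- (a ℤ.* d ℤ.+ b ℤ.* c) ℤ.* f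
                           ≡ a ℤ.* (c ℤ.* e ℤ.- d ℤ.* f) ℤ.- b ℤ.* (c ℤ.* f ℤ.+ d ℤ.* e)
  re-assoc = ℤSolver.solve-∀
  im-assoc : ∀ a b c d e f → (a ℤ.* c ℤ.- b ℤ.* d) ℤ.* f ℤ.+ (a ℤ.* d ℤ.+ b ℤ.* c) ℤ.* e
                           ≡ a ℤ.* (c ℤ.* f ℤ.+ d ℤ.* e) ℤ.+ b ℤ.* (c ℤ.* e ℤ.- d ℤ.* f)
  im-assoc = ℤSolver.solve-∀

*ᵍ-identityˡ : ∀ x → 1ᵍ *ᵍ x ≡ x
*ᵍ-identityˡ (a + b i) = cong₂ _+_i (re-identity a b) (im-identity a b)
  where
  re-identity : ∀ a b → + 1 ℤ.* a ℤ.- + 0 ℤ.* b ≡ a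
  re-identity = ℤSolver.solve-∀
  im-identity : ∀ a b → + 1 ℤ.* b ℤ.+ + 0 ℤ.* a ≡ b
  im-identity = ℤSolver.solve-∀

*ᵍ-identityʳ : ∀ x → x *ᵍ 1ᵍ ≡ x
*ᵍ-identityʳ x = trans (*ᵍ-comm x 1ᵍ) (*ᵍ-identityˡ x)

*ᵍ-distribˡ-+ᵍ : ∀ x y z → x *ᵍ (y +ᵍ z) ≡ x *ᵍ y +ᵍ x *ᵍ z
*ᵍ-distribˡ-+ᵍ (a + b i) (c + d i) (e + f i) = cong₂ _+_i (re-distrib a b c d e f) (im-distrib a b c d e f)
  where
  re-distrib : ∀ a b c d e f → a ℤ.* (c ℤ.+ e) ℤ.- b ℤ.* (d ℤ.+ f)
                             ≡ (a ℤ.* c ℤ.- b ℤ.* d) ℤ.+ (a ℤ.* e ℤ.- b ℤ.* f)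
  re-distrib = ℤSolver.solve-∀
  im-distrib : ∀ a b c d e f → a ℤ.* (d ℤ.+ f) ℤ.+ b ℤ.* (c ℤ.+ e)
                             ≡ (a ℤ.* d ℤ.+ b ℤ.* c) ℤ.+ (a ℤ.* f ℤ.+ b ℤ.* e)
  im-distrib = ℤSolver.solve-∀

*ᵍ-distribʳ-+ᵍ : ∀ x y z → (y +ᵍ z) *ᵍ x ≡ y *ᵍ x +ᵍ z *ᵍ x
*ᵍ-distribʳ-+ᵍ x y z = begin
  (y +ᵍ z) *ᵍ x      ≡⟨ *ᵍ-comm (y +ᵍ z) x ⟩
  x *ᵍ (y +ᵍ z)      ≡⟨ *ᵍ-distribˡ-+ᵍ x y z ⟩
  x *ᵍ y +ᵍ x *ᵍ z   ≡⟨ cong₂ _+ᵍ_ (*ᵍ-comm x y) (*ᵍ-comm x z) ⟩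
  y *ᵍ x +ᵍ z *ᵍ x   ∎
  where open ≡-Reasoning

+ᵍ-*ᵍ-isCommutativeRing : IsCommutativeRing _≡_ _+ᵍ_ _*ᵍ_ -ᵍ_ 0ᵍ 1ᵍ
+ᵍ-*ᵍ-isCommutativeRing = record
  { isRing = record
    { +-isAbelianGroup = record
      { isGroup = record
        { isMonoid = record
          { isSemigroup = record
            { isMagma = record { isEquivalence = isEquivalence ; ∙-cong = cong₂ _+ᵍ_ }
            ; assoc = +ᵍ-assoc }
          ; identity = +ᵍ-identityˡ , +ᵍ-identityʳ }
        ; inverse = -ᵍ-inverseˡ , -ᵍ-inverseʳ
        ; ⁻¹-cong = cong (λ x → -ᵍ x) }
      ; comm = +ᵍ-comm }
    ; *-cong = cong₂ _*ᵍ_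
    ; *-assoc = *ᵍ-assoc
    ; *-identity = *ᵍ-identityˡ , *ᵍ-identityʳ
    ; distrib = *ᵍ-distribˡ-+ᵍ , *ᵍ-distribʳ-+ᵍ }
  ; *-comm = *ᵍ-comm }

+ᵍ-*ᵍ-commutativeRing : CommutativeRing 0ℓ 0ℓ
+ᵍ-*ᵍ-commutativeRing = record { isCommutativeRing = +ᵍ-*ᵍ-isCommutativeRing }

ring : ACR.AlmostCommutativeRing 0ℓ 0ℓ
ring = ACR.fromCommutativeRing +ᵍ-*ᵍ-commutativeRing
  (λ { ((+ 0) + (+ 0) i) → just refl ; _ → nothing })

open CommutativeRing +ᵍ-*ᵍ-commutativeRing using (zeroˡ; zeroʳ)
open import Algebra.Properties.Ring (CommutativeRing.ring +ᵍ-*ᵍ-commutativeRing) using (-‿distribʳ-*; x[y-z]≈xy-xz)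
open import Algebra.Properties.Group (CommutativeRing.+-group +ᵍ-*ᵍ-commutativeRing)
  using (//-rightDividesˡ; //-rightDividesʳ)
open import Algebra.Properties.CommutativeSemigroup (CommutativeRing.*-commutativeSemigroup +ᵍ-*ᵍ-commutativeRing)
  using (interchange)

norm : GZ → ℕ
norm (a + b i) = ∣ a ∣ ℕ.* ∣ a ∣ ℕ.+ ∣ b ∣ ℕ.* ∣ b ∣

+norm≡re²+im² : ∀ x → + norm x ≡ re x ℤ.* re x ℤ.+ im x ℤ.* im x
+norm≡re²+im² (a + b i) = trans (ℤP.pos-+ (∣ a ∣ ℕ.* ∣ a ∣) _) (cong₂ ℤ._+_ (+∣n∣*∣n∣≡n*n a) (+∣n∣*∣n∣≡n*n b))
  where
  +∣n∣*∣n∣≡n*n : ∀ n → + (∣ n ∣ ℕ.* ∣ n ∣) ≡ n ℤ.* n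
  +∣n∣*∣n∣≡n*n (+ n)    = ℤP.pos-* n n
  +∣n∣*∣n∣≡n*n -[1+ n ] = refl

norm-* : ∀ x y → norm (x *ᵍ y) ≡ norm x ℕ.* norm y
norm-* x@(a + b i) y@(c + d i) = ℤP.+-injective (begin
  + norm (x *ᵍ y)                                   ≡⟨ +norm≡re²+im² (x *ᵍ y) ⟩
  re (x *ᵍ y) ℤ.* re (x *ᵍ y) ℤ.+ im (x *ᵍ y) ℤ.* im (x *ᵍ y)
                                                     ≡⟨ brahmagupta a b c d ⟩
  (a ℤ.* a ℤ.+ b ℤ.* b) ℤ.* (c ℤ.* c ℤ.+ d ℤ.* d)   ≡⟨ cong₂ ℤ._*_ (+norm≡re²+im² x) (+norm≡re²+im² y) ⟨
  + norm x ℤ.* + norm y                             ≡⟨ ℤP.pos-* (norm x) (norm y) ⟨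
  + (norm x ℕ.* norm y)                             ∎)
  where
  open ≡-Reasoning
  brahmagupta : ∀ a b c d
    → (a ℤ.* c ℤ.- b ℤ.* d) ℤ.* (a ℤ.* c ℤ.- b ℤ.* d) ℤ.+ (a ℤ.* d ℤ.+ b ℤ.* c) ℤ.* (a ℤ.* d ℤ.+ b ℤ.* c)
    ≡ (a ℤ.* a ℤ.+ b ℤ.* b) ℤ.* (c ℤ.* c ℤ.+ d ℤ.* d)
  brahmagupta = ℤSolver.solve-∀

norm≡0⇒≡0ᵍ : ∀ x → norm x ≡ 0 → x ≡ 0ᵍ
norm≡0⇒≡0ᵍ (a + b i) eq =
  cong₂ _+_i (∣n∣*∣n∣≡0⇒n≡0 a (ℕP.m+n≡0⇒m≡0 _ eq)) (∣n∣*∣n∣≡0⇒n≡0 b (ℕP.m+n≡0⇒n≡0 (∣ a ∣ ℕ.* ∣ a ∣) eq))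
  where
  ∣n∣*∣n∣≡0⇒n≡0 : ∀ n → ∣ n ∣ ℕ.* ∣ n ∣ ≡ 0 → n ≡ + 0
  ∣n∣*∣n∣≡0⇒n≡0 n = ℤP.∣i∣≡0⇒i≡0 ∘ Sum.reduce ∘ ℕP.m*n≡0⇒m≡0∨n≡0 ∣ n ∣

x*y≡0⇒x≡0∨y≡0 : ∀ x y → x *ᵍ y ≡ 0ᵍ → x ≡ 0ᵍ ⊎ y ≡ 0ᵍ
x*y≡0⇒x≡0∨y≡0 x y xy≡0 = Sum.map (norm≡0⇒≡0ᵍ x) (norm≡0⇒≡0ᵍ y)
  (ℕP.m*n≡0⇒m≡0∨n≡0 (norm x) (trans (sym (norm-* x y)) (cong norm xy≡0)))

*ᵍ-cancelˡ : ∀ x {y z} → x ≢ 0ᵍ → x *ᵍ y ≡ x *ᵍ z → y ≡ z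
*ᵍ-cancelˡ x {y} {z} x≢0 xy≡xz =
  [ ⊥-elim ∘ x≢0 , y-z≡0⇒y≡z ] (x*y≡0⇒x≡0∨y≡0 x (y -ᵍ z) x[y-z]≡0)
  where
  open ≡-Reasoning
  x[y-z]≡0 : x *ᵍ (y -ᵍ z) ≡ 0ᵍ
  x[y-z]≡0 = begin
    x *ᵍ (y -ᵍ z)          ≡⟨ x[y-z]≈xy-xz x y z ⟩
    x *ᵍ y -ᵍ x *ᵍ z       ≡⟨ cong (_-ᵍ x *ᵍ z) xy≡xz ⟩
    x *ᵍ z -ᵍ x *ᵍ z       ≡⟨ -ᵍ-inverseʳ (x *ᵍ z) ⟩
    0ᵍ                     ∎
  y-z≡0⇒y≡z : y -ᵍ z ≡ 0ᵍ → y ≡ z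
  y-z≡0⇒y≡z y-z≡0 = begin
    y                      ≡⟨ //-rightDividesˡ z y ⟨
    (y -ᵍ z) +ᵍ z          ≡⟨ cong (_+ᵍ z) y-z≡0 ⟩
    0ᵍ +ᵍ z                ≡⟨ +ᵍ-identityˡ z ⟩
    z                      ∎

∣ᵍ-refl : ∀ x → x ∣ᵍ x
∣ᵍ-refl x = 1ᵍ , sym (*ᵍ-identityʳ x)

∣ᵍ-trans : ∀ x y z → x ∣ᵍ y → y ∣ᵍ z → x ∣ᵍ z
∣ᵍ-trans x y z (c , y≡xc) (d , z≡yd) = c *ᵍ d , trans z≡yd (trans (cong (_*ᵍ d) y≡xc) (*ᵍ-assoc x c d))

∣ᵍ-*ʳ : ∀ x y z → x ∣ᵍ y → x ∣ᵍ (y *ᵍ z)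
∣ᵍ-*ʳ x y z x∣y = ∣ᵍ-trans x y (y *ᵍ z) x∣y (z , refl)

∣ᵍ-*ˡ : ∀ x y z → x ∣ᵍ y → x ∣ᵍ (z *ᵍ y)
∣ᵍ-*ˡ x y z x∣y = subst (x ∣ᵍ_) (*ᵍ-comm y z) (∣ᵍ-*ʳ x y z x∣y)

∣ᵍ-+ : ∀ x y z → x ∣ᵍ y → x ∣ᵍ z → x ∣ᵍ (y +ᵍ z)
∣ᵍ-+ x y z (c , y≡xc) (d , z≡xd) = c +ᵍ d , trans (cong₂ _+ᵍ_ y≡xc z≡xd) (sym (*ᵍ-distribˡ-+ᵍ x c d))

∣ᵍ-- : ∀ x y z → x ∣ᵍ y → x ∣ᵍ z → x ∣ᵍ (y -ᵍ z)
∣ᵍ-- x y z x∣y (d , refl) = ∣ᵍ-+ x y _ x∣y (-ᵍ d , -‿distribʳ-* x d)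

∣ᵍ-0 : ∀ x → x ∣ᵍ 0ᵍ
∣ᵍ-0 x = 0ᵍ , sym (zeroʳ x)

IsUnit⇒norm≡1 : ∀ u → IsUnit u → norm u ≡ 1
IsUnit⇒norm≡1 u (v , 1≡uv) = ℕP.m*n≡1⇒m≡1 (norm u) (norm v) (trans (sym (norm-* u v)) (cong norm (sym 1≡uv)))

norm≡1⇒±1∨±i : ∀ u → norm u ≡ 1 → u ≡ 1ᵍ ⊎ u ≡ iᵍ ⊎ u ≡ -ᵍ 1ᵍ ⊎ u ≡ -ᵍ iᵍ
norm≡1⇒±1∨±i ((+ 0) + (+ 0) i) ()
norm≡1⇒±1∨±i ((+ 0) + (+ 1) i) _ = inj₂ (inj₁ refl)
norm≡1⇒±1∨±i ((+ 0) + (+ suc (suc n)) i) ()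
norm≡1⇒±1∨±i ((+ 0) + -[1+ 0 ] i) _ = inj₂ (inj₂ (inj₂ refl))
norm≡1⇒±1∨±i ((+ 0) + -[1+ suc n ] i) ()
norm≡1⇒±1∨±i ((+ 1) + (+ 0) i) _ = inj₁ refl
norm≡1⇒±1∨±i ((+ 1) + (+ suc n) i) ()
norm≡1⇒±1∨±i ((+ 1) + -[1+ n ] i) ()
norm≡1⇒±1∨±i ((+ suc (suc m)) + b i) ()
norm≡1⇒±1∨±i (-[1+ 0 ] + (+ 0) i) _ = inj₂ (inj₂ (inj₁ refl))
norm≡1⇒±1∨±i (-[1+ 0 ] + (+ suc n) i) ()
norm≡1⇒±1∨±i (-[1+ 0 ] + -[1+ n ] i) ()
norm≡1⇒±1∨±i (-[1+ suc m ] + b i) ()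

-- Euclidean division and Euclid's lemma

∣m⊖n∣≤n : ∀ m n → m ℕ.< n ℕ.+ n → ∣ m ⊖ n ∣ ℕ.≤ n
∣m⊖n∣≤n m zero ()
∣m⊖n∣≤n m n@(suc _) m<2n with m ℕ.≤? n
... | yes m≤n = subst (ℕ._≤ n) (sym (ℤP.∣⊖∣-≤ m≤n)) (ℕP.m∸n≤m n m)
... | no m≰n  = subst (ℕ._≤ n) (sym ∣m⊖n∣≡m∸n) (ℕP.<⇒≤ (ℕP.m<n+o⇒m∸n<o m n m<2n))
  where
  ∣m⊖n∣≡m∸n : ∣ m ⊖ n ∣ ≡ m ℕ.∸ n
  ∣m⊖n∣≡m∸n = trans (ℤP.∣m⊖n∣≡∣n⊖m∣ m n) (ℤP.∣⊖∣-< (ℕP.≰⇒> m≰n))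

-- q is the nearest integer to w / n, read off from the division of 2w + n by 2n.
nearest-multiple : ∀ w n → 0 ℕ.< n → ∃ λ q → ∣ + 2 ℤ.* (w ℤ.- q ℤ.* + n) ∣ ℕ.≤ n
nearest-multiple w n@(suc _) _ =
  q , subst (ℕ._≤ n) (sym (cong ∣_∣ 2[w-qn]≡r⊖n)) (∣m⊖n∣≤n r n (n%ℕd<d D (n ℕ.+ n)))
  where
  open ≡-Reasoning
  D = + 2 ℤ.* w ℤ.+ + n
  q = D /ℕ (n ℕ.+ n)
  r = D %ℕ (n ℕ.+ n)
  rearrange : ∀ w q r n → + 2 ℤ.* w ℤ.+ n ≡ r ℤ.+ q ℤ.* (n ℤ.+ n) → + 2 ℤ.* (w ℤ.- q ℤ.* n) ≡ r ℤ.- n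
  rearrange w q r n eq = begin
    + 2 ℤ.* (w ℤ.- q ℤ.* n)                                 ≡⟨ ℤSolver.solve (w ∷ q ∷ n ∷ []) ⟩
    (+ 2 ℤ.* w ℤ.+ n) ℤ.- q ℤ.* (n ℤ.+ n) ℤ.- n             ≡⟨ cong (λ t → t ℤ.- q ℤ.* (n ℤ.+ n) ℤ.- n) eq ⟩
    (r ℤ.+ q ℤ.* (n ℤ.+ n)) ℤ.- q ℤ.* (n ℤ.+ n) ℤ.- n       ≡⟨ ℤSolver.solve (r ∷ q ∷ n ∷ []) ⟩
    r ℤ.- n                                                 ∎
  2[w-qn]≡r⊖n : + 2 ℤ.* (w ℤ.- q ℤ.* + n) ≡ r ⊖ n
  2[w-qn]≡r⊖n = trans
    (rearrange w q (+ r) (+ n) (trans (a≡a%ℕn+[a/ℕn]*n D (n ℕ.+ n)) (cong (λ m → + r ℤ.+ q ℤ.* m) (ℤP.pos-+ n n))))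
    (ℤP.[+m]-[+n]≡m⊖n r n)

k*n≡u²+v²⇒k<n : ∀ k n u v → 0 ℕ.< n → k ℕ.* n ≡ u ℕ.* u ℕ.+ v ℕ.* v → 2 ℕ.* u ℕ.≤ n → 2 ℕ.* v ℕ.≤ n → k ℕ.< n
k*n≡u²+v²⇒k<n k n@(suc _) u v _ kn≡ 2u≤n 2v≤n =
  ℕP.*-cancelʳ-< n k n (ℕP.*-cancelˡ-< 4 (k ℕ.* n) (n ℕ.* n) 4kn<4nn)
  where
  open ℕP.≤-Reasoning
  4kn<4nn : 4 ℕ.* (k ℕ.* n) ℕ.< 4 ℕ.* (n ℕ.* n)
  4kn<4nn = begin-strict
    4 ℕ.* (k ℕ.* n)                                       ≡⟨ cong (4 ℕ.*_) kn≡ ⟩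
    4 ℕ.* (u ℕ.* u ℕ.+ v ℕ.* v)                           ≡⟨ ℕSolver.solve (u ∷ v ∷ []) ⟩
    (2 ℕ.* u) ℕ.* (2 ℕ.* u) ℕ.+ (2 ℕ.* v) ℕ.* (2 ℕ.* v)   ≤⟨ ℕP.+-mono-≤ (ℕP.*-mono-≤ 2u≤n 2u≤n) (ℕP.*-mono-≤ 2v≤n 2v≤n) ⟩
    n ℕ.* n ℕ.+ n ℕ.* n                                   ≡⟨ cong (n ℕ.* n ℕ.+_) (ℕP.+-identityʳ (n ℕ.* n)) ⟨
    2 ℕ.* (n ℕ.* n)                                       <⟨ ℕP.*-monoˡ-< (n ℕ.* n) (ℕ.s<s (ℕ.s<s (ℕ.z<s {n = 1}))) ⟩
    4 ℕ.* (n ℕ.* n)                                       ∎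

conj : GZ → GZ
conj (a + b i) = a + (ℤ.- b) i

*ᵍ-conj : ∀ x → x *ᵍ conj x ≡ (+ norm x) + (+ 0) i
*ᵍ-conj x@(a + b i) = cong₂ _+_i (trans (re-conj a b) (sym (+norm≡re²+im² x))) (im-conj a b)
  where
  re-conj : ∀ a b → a ℤ.* a ℤ.- b ℤ.* (ℤ.- b) ≡ a ℤ.* a ℤ.+ b ℤ.* b
  re-conj = ℤSolver.solve-∀
  im-conj : ∀ a b → a ℤ.* (ℤ.- b) ℤ.+ b ℤ.* a ≡ + 0
  im-conj = ℤSolver.solve-∀

norm-conj : ∀ x → norm (conj x) ≡ norm x
norm-conj (a + b i) = cong (λ m → ∣ a ∣ ℕ.* ∣ a ∣ ℕ.+ m ℕ.* m) (ℤP.∣-i∣≡∣i∣ b)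

-- Rounding a * conj b / norm b componentwise leaves a remainder of norm at most norm b / 2.
euclidean-division : ∀ a b → 0 ℕ.< norm b → ∃ λ q → norm (a -ᵍ q *ᵍ b) ℕ.< norm b
euclidean-division a b n>0
  with nearest-multiple (re (a *ᵍ conj b)) (norm b) n>0 | nearest-multiple (im (a *ᵍ conj b)) (norm b) n>0
... | q₁ , bound₁ | q₂ , bound₂ =
  q , k*n≡u²+v²⇒k<n (norm r) n ∣ e₁ ∣ ∣ e₂ ∣ n>0 norm[r]*n≡
        (subst (ℕ._≤ n) (ℤP.∣i*j∣≡∣i∣*∣j∣ (+ 2) e₁) bound₁)
        (subst (ℕ._≤ n) (ℤP.∣i*j∣≡∣i∣*∣j∣ (+ 2) e₂) bound₂)
  where
  open ≡-Reasoning
  n = norm b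
  w = a *ᵍ conj b
  q = q₁ + q₂ i
  r = a -ᵍ q *ᵍ b
  e₁ = re w ℤ.- q₁ ℤ.* + n
  e₂ = im w ℤ.- q₂ ℤ.* + n
  r*conj[b]≡ : r *ᵍ conj b ≡ e₁ + e₂ i
  r*conj[b]≡ = begin
    (a -ᵍ q *ᵍ b) *ᵍ conj b          ≡⟨ distribute a q b (conj b) ⟩
    w -ᵍ q *ᵍ (b *ᵍ conj b)          ≡⟨ cong (λ m → w -ᵍ q *ᵍ m) (*ᵍ-conj b) ⟩
    w -ᵍ q *ᵍ ((+ n) + (+ 0) i)      ≡⟨ cong₂ _+_i (re-eq (re w) q₁ q₂ (+ n)) (im-eq (im w) q₁ q₂ (+ n)) ⟩
    e₁ + e₂ i                        ∎
    where
    distribute : ∀ a q b c → (a -ᵍ q *ᵍ b) *ᵍ c ≡ a *ᵍ c -ᵍ q *ᵍ (b *ᵍ c)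
    distribute a q b c = Solver.solve (a ∷ q ∷ b ∷ c ∷ []) ring
    re-eq : ∀ w₁ q₁ q₂ n → w₁ ℤ.+ ℤ.- (q₁ ℤ.* n ℤ.- q₂ ℤ.* + 0) ≡ w₁ ℤ.- q₁ ℤ.* n
    re-eq = ℤSolver.solve-∀
    im-eq : ∀ w₂ q₁ q₂ n → w₂ ℤ.+ ℤ.- (q₁ ℤ.* + 0 ℤ.+ q₂ ℤ.* n) ≡ w₂ ℤ.- q₂ ℤ.* n
    im-eq = ℤSolver.solve-∀
  norm[r]*n≡ : norm r ℕ.* n ≡ ∣ e₁ ∣ ℕ.* ∣ e₁ ∣ ℕ.+ ∣ e₂ ∣ ℕ.* ∣ e₂ ∣
  norm[r]*n≡ = begin
    norm r ℕ.* n                   ≡⟨ cong (norm r ℕ.*_) (norm-conj b) ⟨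
    norm r ℕ.* norm (conj b)       ≡⟨ norm-* r (conj b) ⟨
    norm (r *ᵍ conj b)             ≡⟨ cong norm r*conj[b]≡ ⟩
    norm (e₁ + e₂ i)               ∎

record Bézout (a b : GZ) : Set where
  field
    d x y : GZ
    d∣a   : d ∣ᵍ a
    d∣b   : d ∣ᵍ b
    d≡    : d ≡ x *ᵍ a +ᵍ y *ᵍ b

bezout-< : ∀ k a b → norm b ℕ.< k → Bézout a b
bezout-< zero    a b ()
bezout-< (suc k) a b nb≤k with norm b ≟ 0
... | yes nb≡0 = record
  { d = a ; x = 1ᵍ ; y = 0ᵍ
  ; d∣a = ∣ᵍ-refl a
  ; d∣b = subst (a ∣ᵍ_) (sym (norm≡0⇒≡0ᵍ b nb≡0)) (∣ᵍ-0 a)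
  ; d≡ = sym (trans (cong₂ _+ᵍ_ (*ᵍ-identityˡ a) (zeroˡ b)) (+ᵍ-identityʳ a)) }
... | no nb≢0 = divide (euclidean-division a b (ℕP.n≢0⇒n>0 nb≢0))
  where
  divide : (∃ λ q → norm (a -ᵍ q *ᵍ b) ℕ.< norm b) → Bézout a b
  divide (q , nr<nb) = record
    { d = B.d ; x = B.y ; y = B.x -ᵍ B.y *ᵍ q
    ; d∣a = subst (B.d ∣ᵍ_) (//-rightDividesˡ (q *ᵍ b) a) (∣ᵍ-+ B.d r (q *ᵍ b) B.d∣b (∣ᵍ-*ˡ B.d b q B.d∣a))
    ; d∣b = B.d∣a
    ; d≡ = trans B.d≡ (regroup B.x B.y a q b) }
    where
    r = a -ᵍ q *ᵍ b
    module B = Bézout (bezout-< k b r (ℕP.<-≤-trans nr<nb (ℕ.s≤s⁻¹ nb≤k)))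
    regroup : ∀ x y a q b → x *ᵍ b +ᵍ y *ᵍ (a -ᵍ q *ᵍ b) ≡ y *ᵍ a +ᵍ (x -ᵍ y *ᵍ q) *ᵍ b
    regroup x y a q b = Solver.solve (x ∷ y ∷ a ∷ q ∷ b ∷ []) ring

bezout : ∀ a b → Bézout a b
bezout a b = bezout-< (suc (norm b)) a b (ℕP.n<1+n (norm b))

IsPrimeᵍ : GZ → Set
IsPrimeᵍ p = p ≢ 0ᵍ × ¬ IsUnit p × (∀ a b → p ∣ᵍ (a *ᵍ b) → p ∣ᵍ a ⊎ p ∣ᵍ b)

irreducible⇒prime : ∀ p → IsGaussianPrime p → IsPrimeᵍ p
irreducible⇒prime p (p≢0 , ¬unit , irreducible) = p≢0 , ¬unit , euclid
  where
  euclid : ∀ a b → p ∣ᵍ (a *ᵍ b) → p ∣ᵍ a ⊎ p ∣ᵍ b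
  euclid a b p∣ab = [ d-unit⇒p∣b , (λ p∣d → inj₁ (∣ᵍ-trans p d a p∣d d∣a)) ] (irreducible d d∣p)
    where
    open Bézout (bezout p a) renaming (d∣a to d∣p; d∣b to d∣a)
    d-unit⇒p∣b : IsUnit d → p ∣ᵍ a ⊎ p ∣ᵍ b
    d-unit⇒p∣b (v , 1≡dv) = inj₂ (subst (p ∣ᵍ_) b[xp+ya]v≡b
      (subst (p ∣ᵍ_) (expand b x y v) (∣ᵍ-+ p _ _ (b *ᵍ x *ᵍ v , refl) (∣ᵍ-*ˡ p (a *ᵍ b) (y *ᵍ v) p∣ab))))
      where
      open ≡-Reasoning
      expand : ∀ b x y v → p *ᵍ (b *ᵍ x *ᵍ v) +ᵍ (y *ᵍ v) *ᵍ (a *ᵍ b) ≡ b *ᵍ ((x *ᵍ p +ᵍ y *ᵍ a) *ᵍ v)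
      expand b x y v = Solver.solve (a ∷ b ∷ p ∷ x ∷ y ∷ v ∷ []) ring
      b[xp+ya]v≡b : b *ᵍ ((x *ᵍ p +ᵍ y *ᵍ a) *ᵍ v) ≡ b
      b[xp+ya]v≡b = begin
        b *ᵍ ((x *ᵍ p +ᵍ y *ᵍ a) *ᵍ v)   ≡⟨ cong (λ e → b *ᵍ (e *ᵍ v)) d≡ ⟨
        b *ᵍ (d *ᵍ v)                    ≡⟨ cong (b *ᵍ_) 1≡dv ⟨
        b *ᵍ 1ᵍ                          ≡⟨ *ᵍ-identityʳ b ⟩
        b                                ∎

1+i∣⇒2∣re+im : ∀ x → 1+i ∣ᵍ x → + 2 ℤ∣.∣ re x ℤ.+ im x
1+i∣⇒2∣re+im x (c + d i , refl) = ℤ∣.divides c (re+im≡c*2 c d)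
  where
  re+im≡c*2 : ∀ c d → (+ 1 ℤ.* c ℤ.- + 1 ℤ.* d) ℤ.+ (+ 1 ℤ.* d ℤ.+ + 1 ℤ.* c) ≡ c ℤ.* + 2
  re+im≡c*2 = ℤSolver.solve-∀

2∣re+im⇒1+i∣ : ∀ x → + 2 ℤ∣.∣ re x ℤ.+ im x → 1+i ∣ᵍ x
2∣re+im⇒1+i∣ (a + b i) (ℤ∣.divides m a+b≡m*2) = m + (m ℤ.- a) i , cong₂ _+_i (re≡ a m) im≡
  where
  open ≡-Reasoning
  re≡ : ∀ a m → a ≡ + 1 ℤ.* m ℤ.- + 1 ℤ.* (m ℤ.- a)
  re≡ = ℤSolver.solve-∀
  im≡ : b ≡ + 1 ℤ.* (m ℤ.- a) ℤ.+ + 1 ℤ.* m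
  im≡ = begin
    b                                   ≡⟨ ℤSolver.solve (a ∷ b ∷ []) ⟩
    (a ℤ.+ b) ℤ.- a                     ≡⟨ cong (ℤ._- a) a+b≡m*2 ⟩
    m ℤ.* + 2 ℤ.- a                     ≡⟨ ℤSolver.solve (a ∷ m ∷ []) ⟩
    + 1 ℤ.* (m ℤ.- a) ℤ.+ + 1 ℤ.* m     ∎

-- 1+i ∣ x iff re x + im x is even, and re (x y) + im (x y) ≡ (a + b)(c + d) mod 2,
-- so Euclid's lemma for 1+i is the one for the prime 2 in ℕ.
1+i-isPrime : IsPrimeᵍ 1+i
1+i-isPrime = (λ ()) , (λ unit → 2≢1 (IsUnit⇒norm≡1 1+i unit)) , euclid
  where
  2≢1 : 2 ≢ 1
  2≢1 ()
  euclid : ∀ x y → 1+i ∣ᵍ (x *ᵍ y) → 1+i ∣ᵍ x ⊎ 1+i ∣ᵍ y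
  euclid x@(a + b i) y@(c + d i) 1+i∣xy =
    Sum.map (2∣re+im⇒1+i∣ x ∘ ℤ∣.∣ᵤ⇒∣) (2∣re+im⇒1+i∣ y ∘ ℤ∣.∣ᵤ⇒∣)
      (euclidsLemma ∣ a ℤ.+ b ∣ ∣ c ℤ.+ d ∣ (from-yes (prime? 2))
        (subst (2 ℕ∣.∣_) (ℤP.∣i*j∣≡∣i∣*∣j∣ (a ℤ.+ b) (c ℤ.+ d)) (ℤ∣.∣⇒∣ᵤ 2∣[a+b][c+d])))
    where
    expand : ∀ a b c d → (a ℤ.* c ℤ.- b ℤ.* d) ℤ.+ (a ℤ.* d ℤ.+ b ℤ.* c) ℤ.+ (b ℤ.* d) ℤ.* + 2
                       ≡ (a ℤ.+ b) ℤ.* (c ℤ.+ d)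
    expand = ℤSolver.solve-∀
    2∣[a+b][c+d] : + 2 ℤ∣.∣ (a ℤ.+ b) ℤ.* (c ℤ.+ d)
    2∣[a+b][c+d] = subst (+ 2 ℤ∣.∣_) (expand a b c d)
      (ℤ∣.∣m∣n⇒∣m+n (1+i∣⇒2∣re+im (x *ᵍ y) 1+i∣xy) (ℤ∣.divides (b ℤ.* d) refl))

-- Splitting a unit times a square along coprime factors

^ᵍ-distribˡ-+-*ᵍ : ∀ x m n → x ^ᵍ (m ℕ.+ n) ≡ x ^ᵍ m *ᵍ x ^ᵍ n
^ᵍ-distribˡ-+-*ᵍ x zero    n = sym (*ᵍ-identityˡ (x ^ᵍ n))
^ᵍ-distribˡ-+-*ᵍ x (suc m) n = trans (cong (x *ᵍ_) (^ᵍ-distribˡ-+-*ᵍ x m n)) (sym (*ᵍ-assoc x (x ^ᵍ m) (x ^ᵍ n)))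

x*[1*1]≡x : ∀ x → x *ᵍ (1ᵍ *ᵍ 1ᵍ) ≡ x
x*[1*1]≡x x = trans (cong (x *ᵍ_) (*ᵍ-identityˡ 1ᵍ)) (*ᵍ-identityʳ x)

p²-peel : ∀ p → IsPrimeᵍ p → ∀ {A B} M → ¬ p ∣ᵍ B → p ∣ᵍ A → A *ᵍ B ≡ p *ᵍ (p *ᵍ M)
        → ∃ λ A′ → A ≡ (p *ᵍ p) *ᵍ A′ × A′ *ᵍ B ≡ M
p²-peel p (p≢0 , _ , euclid) {A} {B} M p∤B (A₁ , A≡pA₁) AB≡ppM =
  [ peel , ⊥-elim ∘ p∤B ] (euclid A₁ B (M , A₁B≡pM))
  where
  open ≡-Reasoning
  A₁B≡pM : A₁ *ᵍ B ≡ p *ᵍ M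
  A₁B≡pM = *ᵍ-cancelˡ p p≢0 (begin
    p *ᵍ (A₁ *ᵍ B)   ≡⟨ *ᵍ-assoc p A₁ B ⟨
    p *ᵍ A₁ *ᵍ B     ≡⟨ cong (_*ᵍ B) A≡pA₁ ⟨
    A *ᵍ B           ≡⟨ AB≡ppM ⟩
    p *ᵍ (p *ᵍ M)    ∎)
  peel : p ∣ᵍ A₁ → ∃ λ A′ → A ≡ (p *ᵍ p) *ᵍ A′ × A′ *ᵍ B ≡ M
  peel (A′ , A₁≡pA′) =
    A′ , trans A≡pA₁ (trans (cong (p *ᵍ_) A₁≡pA′) (sym (*ᵍ-assoc p p A′))) ,
    *ᵍ-cancelˡ p p≢0 (begin
      p *ᵍ (A′ *ᵍ B)   ≡⟨ *ᵍ-assoc p A′ B ⟨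
      p *ᵍ A′ *ᵍ B     ≡⟨ cong (_*ᵍ B) A₁≡pA′ ⟨
      A₁ *ᵍ B          ≡⟨ A₁B≡pM ⟩
      p *ᵍ M           ∎)

record PowerSplit (p : GZ) (a : ℕ) (A B c N : GZ) : Set where
  field
    e₁ e₂   : ℕ
    A′ B′   : GZ
    e₁+e₂≡a : e₁ ℕ.+ e₂ ≡ a
    A≡      : A ≡ A′ *ᵍ (p ^ᵍ e₁ *ᵍ p ^ᵍ e₁)
    B≡      : B ≡ B′ *ᵍ (p ^ᵍ e₂ *ᵍ p ^ᵍ e₂)
    A′B′≡   : A′ *ᵍ B′ ≡ c *ᵍ (N *ᵍ N)

-- p divides at most one of A and B, so each factor p² of A B comes off one of them whole.
split-prime-power : ∀ p → IsPrimeᵍ p → ∀ a {A B} c N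
  → (0 ℕ.< a → p ∣ᵍ A → p ∣ᵍ B → ⊥)
  → A *ᵍ B ≡ c *ᵍ ((p ^ᵍ a *ᵍ N) *ᵍ (p ^ᵍ a *ᵍ N))
  → PowerSplit p a A B c N
split-prime-power p _ zero {A} {B} c N _ AB≡ = record
  { e₁ = 0 ; e₂ = 0 ; A′ = A ; B′ = B ; e₁+e₂≡a = refl
  ; A≡ = sym (x*[1*1]≡x A) ; B≡ = sym (x*[1*1]≡x B)
  ; A′B′≡ = trans AB≡ (cong (λ m → c *ᵍ (m *ᵍ m)) (*ᵍ-identityˡ N)) }
split-prime-power p p-prime@(_ , _ , euclid) (suc a) {A} {B} c N coprime AB≡ =
  [ peel-A , peel-B ] (euclid A B (p *ᵍ M , AB≡ppM))
  where
  M = c *ᵍ ((p ^ᵍ a *ᵍ N) *ᵍ (p ^ᵍ a *ᵍ N))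
  AB≡ppM : A *ᵍ B ≡ p *ᵍ (p *ᵍ M)
  AB≡ppM = trans AB≡ (pull-out c p (p ^ᵍ a) N)
    where
    pull-out : ∀ c p q N → c *ᵍ ((p *ᵍ q *ᵍ N) *ᵍ (p *ᵍ q *ᵍ N)) ≡ p *ᵍ (p *ᵍ (c *ᵍ ((q *ᵍ N) *ᵍ (q *ᵍ N))))
    pull-out c p q N = Solver.solve (c ∷ p ∷ q ∷ N ∷ []) ring
  absorb : ∀ A′ p q → (p *ᵍ p) *ᵍ (A′ *ᵍ (q *ᵍ q)) ≡ A′ *ᵍ ((p *ᵍ q) *ᵍ (p *ᵍ q))
  absorb A′ p q = Solver.solve (A′ ∷ p ∷ q ∷ []) ring
  p∣ppX : ∀ {X Y} → X ≡ (p *ᵍ p) *ᵍ Y → p ∣ᵍ Y → p ∣ᵍ X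
  p∣ppX {X} {Y} X≡ p∣Y = subst (p ∣ᵍ_) (sym X≡) (∣ᵍ-*ˡ p Y (p *ᵍ p) p∣Y)

  peel-A : p ∣ᵍ A → PowerSplit p (suc a) A B c N
  peel-A p∣A = extend (p²-peel p p-prime M (coprime ℕ.z<s p∣A) p∣A AB≡ppM)
    where
    extend : (∃ λ A₂ → A ≡ (p *ᵍ p) *ᵍ A₂ × A₂ *ᵍ B ≡ M) → PowerSplit p (suc a) A B c N
    extend (A₂ , A≡ppA₂ , A₂B≡M) = record
      { e₁ = suc R.e₁ ; e₂ = R.e₂ ; A′ = R.A′ ; B′ = R.B′
      ; e₁+e₂≡a = cong suc R.e₁+e₂≡a
      ; A≡ = trans A≡ppA₂ (trans (cong ((p *ᵍ p) *ᵍ_) R.A≡) (absorb R.A′ p (p ^ᵍ R.e₁)))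
      ; B≡ = R.B≡
      ; A′B′≡ = R.A′B′≡ }
      where
      module R = PowerSplit (split-prime-power p p-prime a c N
        (λ _ p∣A₂ → coprime ℕ.z<s (p∣ppX A≡ppA₂ p∣A₂)) A₂B≡M)

  peel-B : p ∣ᵍ B → PowerSplit p (suc a) A B c N
  peel-B p∣B = extend (p²-peel p p-prime M (λ p∣A → coprime ℕ.z<s p∣A p∣B) p∣B (trans (*ᵍ-comm B A) AB≡ppM))
    where
    extend : (∃ λ B₂ → B ≡ (p *ᵍ p) *ᵍ B₂ × B₂ *ᵍ A ≡ M) → PowerSplit p (suc a) A B c N
    extend (B₂ , B≡ppB₂ , B₂A≡M) = record
      { e₁ = R.e₁ ; e₂ = suc R.e₂ ; A′ = R.A′ ; B′ = R.B′
      ; e₁+e₂≡a = trans (ℕP.+-suc R.e₁ R.e₂) (cong suc R.e₁+e₂≡a)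
      ; A≡ = R.A≡
      ; B≡ = trans B≡ppB₂ (trans (cong ((p *ᵍ p) *ᵍ_) R.B≡) (absorb R.B′ p (p ^ᵍ R.e₂)))
      ; A′B′≡ = R.A′B′≡ }
      where
      module R = PowerSplit (split-prime-power p p-prime a c N
        (λ _ p∣A p∣B₂ → coprime ℕ.z<s p∣A (p∣ppX B≡ppB₂ p∣B₂)) (trans (*ᵍ-comm A B₂) B₂A≡M))

record SquareSplit (F : List (GZ × ℕ)) (A B c : GZ) : Set where
  field
    ps₁ ps₂     : List (GZ × ℕ)
    ps₁-primes  : map proj₁ ps₁ ≡ map proj₁ F
    ps₂-primes  : map proj₁ ps₂ ≡ map proj₁ F
    A₀ B₀       : GZ
    P*Q≡        : prodPow ps₁ *ᵍ prodPow ps₂ ≡ prodPow F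
    A≡          : A ≡ A₀ *ᵍ (prodPow ps₁ *ᵍ prodPow ps₁)
    B≡          : B ≡ B₀ *ᵍ (prodPow ps₂ *ᵍ prodPow ps₂)
    A₀B₀≡c      : A₀ *ᵍ B₀ ≡ c

split-squares : ∀ F → All (IsPrimeᵍ ∘ proj₁) F → ∀ {A B} c
  → A *ᵍ B ≡ c *ᵍ (prodPow F *ᵍ prodPow F)
  → (∀ d → d ∣ᵍ A → d ∣ᵍ B → d ∣ᵍ prodPow F → IsUnit d)
  → SquareSplit F A B c
split-squares [] _ {A} {B} c AB≡ _ = record
  { ps₁ = [] ; ps₂ = [] ; ps₁-primes = refl ; ps₂-primes = refl ; A₀ = A ; B₀ = B
  ; P*Q≡ = *ᵍ-identityˡ 1ᵍ ; A≡ = sym (x*[1*1]≡x A) ; B≡ = sym (x*[1*1]≡x B)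
  ; A₀B₀≡c = trans AB≡ (x*[1*1]≡x c) }
split-squares ((p , a) ∷ F) (p-prime All.∷ F-primes) {A} {B} c AB≡ coprime = record
  { ps₁ = (p , R.e₁) ∷ S.ps₁ ; ps₂ = (p , R.e₂) ∷ S.ps₂
  ; ps₁-primes = cong (p ∷_) S.ps₁-primes ; ps₂-primes = cong (p ∷_) S.ps₂-primes
  ; A₀ = S.A₀ ; B₀ = S.B₀
  ; P*Q≡ = trans (interchange (p ^ᵍ R.e₁) (prodPow S.ps₁) (p ^ᵍ R.e₂) (prodPow S.ps₂))
                 (cong₂ _*ᵍ_ p^e₁*p^e₂≡p^a S.P*Q≡)
  ; A≡ = trans R.A≡ (trans (cong (_*ᵍ (p ^ᵍ R.e₁ *ᵍ p ^ᵍ R.e₁)) S.A≡) (absorb S.A₀ (prodPow S.ps₁) (p ^ᵍ R.e₁)))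
  ; B≡ = trans R.B≡ (trans (cong (_*ᵍ (p ^ᵍ R.e₂ *ᵍ p ^ᵍ R.e₂)) S.B≡) (absorb S.B₀ (prodPow S.ps₂) (p ^ᵍ R.e₂)))
  ; A₀B₀≡c = S.A₀B₀≡c }
  where
  M = prodPow F
  p∣p^a*M : 0 ℕ.< a → p ∣ᵍ (p ^ᵍ a *ᵍ M)
  p∣p^a*M (ℕ.s≤s _) = ∣ᵍ-*ʳ p (p ^ᵍ a) M (_ , refl)
  module R = PowerSplit (split-prime-power p p-prime a c M
    (λ 0<a p∣A p∣B → proj₁ (proj₂ p-prime) (coprime p p∣A p∣B (p∣p^a*M 0<a))) AB≡)
  module S = SquareSplit (split-squares F F-primes c R.A′B′≡
    (λ d d∣A′ d∣B′ d∣M → coprime d (∣ᵍ-trans d R.A′ A d∣A′ (_ , R.A≡)) (∣ᵍ-trans d R.B′ B d∣B′ (_ , R.B≡))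
                                   (∣ᵍ-*ˡ d M (p ^ᵍ a) d∣M)))
  p^e₁*p^e₂≡p^a : p ^ᵍ R.e₁ *ᵍ p ^ᵍ R.e₂ ≡ p ^ᵍ a
  p^e₁*p^e₂≡p^a = trans (sym (^ᵍ-distribˡ-+-*ᵍ p R.e₁ R.e₂)) (cong (p ^ᵍ_) R.e₁+e₂≡a)
  absorb : ∀ A₀ P q → (A₀ *ᵍ (P *ᵍ P)) *ᵍ (q *ᵍ q) ≡ A₀ *ᵍ ((q *ᵍ P) *ᵍ (q *ᵍ P))
  absorb A₀ P q = Solver.solve (A₀ ∷ P ∷ q ∷ []) ring

-- The parametrisation

InOI-form : ∀ x → InOI x → ∃ λ k → ∃ λ m → x ≡ (+ 1 ℤ.+ + 4 ℤ.* k) + (+ 2 ℤ.* m ℤ.- + 4 ℤ.* k) i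
InOI-form (a + b i) ((m , a+b≡) , (k , a≡)) = k , m , cong₂ _+_i a≡ (begin
  b                                                  ≡⟨ ℤSolver.solve (a ∷ b ∷ []) ⟩
  (a ℤ.+ b) ℤ.- a                                    ≡⟨ cong₂ ℤ._-_ a+b≡ a≡ ⟩
  (+ 1 ℤ.+ + 2 ℤ.* m) ℤ.- (+ 1 ℤ.+ + 4 ℤ.* k)        ≡⟨ ℤSolver.solve (m ∷ k ∷ []) ⟩
  + 2 ℤ.* m ℤ.- + 4 ℤ.* k                            ∎)
  where open ≡-Reasoning

InOI-difference-even : ∀ X Z → InOI X → InOI Z → ∃ λ D → Z ≡ X +ᵍ (D +ᵍ D)
InOI-difference-even X Z X∈OI Z∈OI with InOI-form X X∈OI | InOI-form Z Z∈OI
... | k , m , refl | k′ , m′ , refl =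
  (+ 2 ℤ.* (k′ ℤ.- k)) + (m′ ℤ.- m ℤ.- + 2 ℤ.* (k′ ℤ.- k)) i ,
  cong₂ _+_i (re-eq k k′) (im-eq k m k′ m′)
  where
  re-eq : ∀ k k′ → + 1 ℤ.+ + 4 ℤ.* k′ ≡ (+ 1 ℤ.+ + 4 ℤ.* k) ℤ.+ (+ 2 ℤ.* (k′ ℤ.- k) ℤ.+ + 2 ℤ.* (k′ ℤ.- k))
  re-eq = ℤSolver.solve-∀
  im-eq : ∀ k m k′ m′ → + 2 ℤ.* m′ ℤ.- + 4 ℤ.* k′
        ≡ (+ 2 ℤ.* m ℤ.- + 4 ℤ.* k)
          ℤ.+ ((m′ ℤ.- m ℤ.- + 2 ℤ.* (k′ ℤ.- k)) ℤ.+ (m′ ℤ.- m ℤ.- + 2 ℤ.* (k′ ℤ.- k)))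
  im-eq = ℤSolver.solve-∀

-- Z² - X² = 4 (X + D) D and i Y² = -4 i W²; cancel the 4.
pythagorean⇒product : ∀ {X Y Z} D W → Z ≡ X +ᵍ (D +ᵍ D) → Y ≡ (1+i ^ᵍ 2) *ᵍ W
  → X *ᵍ X +ᵍ iᵍ *ᵍ (Y *ᵍ Y) ≡ Z *ᵍ Z → (X +ᵍ D) *ᵍ D ≡ (-ᵍ iᵍ) *ᵍ (W *ᵍ W)
pythagorean⇒product {X} D W refl refl pyth = *ᵍ-cancelˡ 4ᵍ (λ ()) (begin
  4ᵍ *ᵍ ((X +ᵍ D) *ᵍ D)                                        ≡⟨ Solver.solve (X ∷ D ∷ []) ring ⟩
  (X +ᵍ (D +ᵍ D)) *ᵍ (X +ᵍ (D +ᵍ D)) -ᵍ X *ᵍ X                  ≡⟨ cong (_-ᵍ X *ᵍ X) pyth ⟨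
  X *ᵍ X +ᵍ iᵍ *ᵍ (((1+i ^ᵍ 2) *ᵍ W) *ᵍ ((1+i ^ᵍ 2) *ᵍ W)) -ᵍ X *ᵍ X ≡⟨ Solver.solve (X ∷ W ∷ []) ring ⟩
  4ᵍ *ᵍ ((-ᵍ iᵍ) *ᵍ (W *ᵍ W))                                  ∎)
  where
  open ≡-Reasoning
  4ᵍ : GZ
  4ᵍ = (+ 4) + (+ 0) i

-- Each unit u is i^(t+1) for some t ∈ {0,1,2,3}, and then u² (-1)^t = -1 determines B₀.
factors-of-minus-i : ∀ u B₀ → u ≡ 1ᵍ ⊎ u ≡ iᵍ ⊎ u ≡ -ᵍ 1ᵍ ⊎ u ≡ -ᵍ iᵍ → u *ᵍ B₀ ≡ -ᵍ iᵍ
  → ∃ λ t → u ≡ iPow (t + + 1) × B₀ ≡ iPow (t + + 1) *ᵍ (negOnePow t *ᵍ iᵍ)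
factors-of-minus-i u B₀ (inj₁ refl)               uB₀≡-i = + 3 , refl , *ᵍ-cancelˡ u (λ ()) uB₀≡-i
factors-of-minus-i u B₀ (inj₂ (inj₁ refl))        uB₀≡-i = + 0 , refl , *ᵍ-cancelˡ u (λ ()) uB₀≡-i
factors-of-minus-i u B₀ (inj₂ (inj₂ (inj₁ refl))) uB₀≡-i = + 1 , refl , *ᵍ-cancelˡ u (λ ()) uB₀≡-i
factors-of-minus-i u B₀ (inj₂ (inj₂ (inj₂ refl))) uB₀≡-i = + 2 , refl , *ᵍ-cancelˡ u (λ ()) uB₀≡-i

sum-and-difference : ∀ {X D} u v P Q → X +ᵍ D ≡ u *ᵍ (P *ᵍ P) → D ≡ u *ᵍ v *ᵍ (Q *ᵍ Q)
  → X ≡ u *ᵍ (P *ᵍ P -ᵍ v *ᵍ (Q *ᵍ Q)) × X +ᵍ (D +ᵍ D) ≡ u *ᵍ (P *ᵍ P +ᵍ v *ᵍ (Q *ᵍ Q))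
sum-and-difference {X} {D} u v P Q X+D≡ D≡ = X≡ , X+2D≡
  where
  open ≡-Reasoning
  X≡ : X ≡ u *ᵍ (P *ᵍ P -ᵍ v *ᵍ (Q *ᵍ Q))
  X≡ = begin
    X                                      ≡⟨ //-rightDividesʳ D X ⟨
    (X +ᵍ D) -ᵍ D                          ≡⟨ cong₂ _-ᵍ_ X+D≡ D≡ ⟩
    u *ᵍ (P *ᵍ P) -ᵍ u *ᵍ v *ᵍ (Q *ᵍ Q)    ≡⟨ Solver.solve (u ∷ v ∷ P ∷ Q ∷ []) ring ⟩
    u *ᵍ (P *ᵍ P -ᵍ v *ᵍ (Q *ᵍ Q))         ∎
  X+2D≡ : X +ᵍ (D +ᵍ D) ≡ u *ᵍ (P *ᵍ P +ᵍ v *ᵍ (Q *ᵍ Q))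
  X+2D≡ = begin
    X +ᵍ (D +ᵍ D)                          ≡⟨ +ᵍ-assoc X D D ⟨
    (X +ᵍ D) +ᵍ D                          ≡⟨ cong₂ _+ᵍ_ X+D≡ D≡ ⟩
    u *ᵍ (P *ᵍ P) +ᵍ u *ᵍ v *ᵍ (Q *ᵍ Q)    ≡⟨ Solver.solve (u ∷ v ∷ P ∷ Q ∷ []) ring ⟩
    u *ᵍ (P *ᵍ P +ᵍ v *ᵍ (Q *ᵍ Q))         ∎

coprime-parametrisation : ∀ {X Y} u v c P Q → Coprimeᵍ X Y
  → X ≡ u *ᵍ (P *ᵍ P -ᵍ v *ᵍ (Q *ᵍ Q)) → Y ≡ c *ᵍ P *ᵍ Q → Coprimeᵍ P Q
coprime-parametrisation u v c P Q coprime refl refl d d∣P d∣Q = coprime d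
  (∣ᵍ-*ˡ d _ u (∣ᵍ-- d (P *ᵍ P) (v *ᵍ (Q *ᵍ Q)) (∣ᵍ-*ʳ d P P d∣P) (∣ᵍ-*ˡ d (Q *ᵍ Q) v (∣ᵍ-*ʳ d Q Q d∣Q))))
  (∣ᵍ-*ˡ d Q (c *ᵍ P) d∣Q)

InG-prodPow : (ps qs : List (GZ × ℕ)) → AllPairs _≢_ (map proj₁ ps)
  → All (λ pa → IsGaussianPrime (proj₁ pa) × InOI (proj₁ pa)) ps
  → map proj₁ qs ≡ 1+i ∷ map proj₁ ps → InG (prodPow qs)
InG-prodPow ps [] _ _ ()
InG-prodPow ps ((q , e) ∷ qs) distinct primes q∷qs≡ with ∷-injective q∷qs≡
... | refl , qs≡ps =
  e , qs , subst (AllPairs _≢_) (sym qs≡ps) distinct ,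
  map⁻ (subst (All (λ p → IsGaussianPrime p × InOI p)) (sym qs≡ps) (map⁺ primes)) , refl

Parametrisation : GZ → GZ → GZ → Set
Parametrisation X Y Z = ∃ λ (t : ℤ) → ∃ λ P → ∃ λ Q → InG P × InG Q × Coprimeᵍ P Q
  × X ≡ iPow (t + + 1) *ᵍ (P *ᵍ P -ᵍ negOnePow t *ᵍ iᵍ *ᵍ (Q *ᵍ Q))
  × Y ≡ (1+i ^ᵍ 2) *ᵍ P *ᵍ Q
  × Z ≡ iPow (t + + 1) *ᵍ (P *ᵍ P +ᵍ negOnePow t *ᵍ iᵍ *ᵍ (Q *ᵍ Q))

split⇒parametrisation : ∀ {X Y Z D} a ps → AllPairs _≢_ (map proj₁ ps)
  → All (λ pa → IsGaussianPrime (proj₁ pa) × InOI (proj₁ pa)) ps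
  → Coprimeᵍ X Y → Z ≡ X +ᵍ (D +ᵍ D) → Y ≡ (1+i ^ᵍ 2) *ᵍ prodPow ((1+i , a) ∷ ps)
  → SquareSplit ((1+i , a) ∷ ps) (X +ᵍ D) D (-ᵍ iᵍ) → Parametrisation X Y Z
split⇒parametrisation {X} {Y} {Z} {D} a ps distinct primes coprime refl refl S =
  from-unit (factors-of-minus-i A₀ B₀ (norm≡1⇒±1∨±i A₀ (IsUnit⇒norm≡1 A₀ A₀-unit)) A₀B₀≡c)
  where
  open SquareSplit S
  P = prodPow ps₁
  Q = prodPow ps₂
  A₀-unit : IsUnit A₀
  A₀-unit = ∣ᵍ-trans A₀ (A₀ *ᵍ B₀) 1ᵍ (B₀ , refl) (subst IsUnit (sym A₀B₀≡c) (iᵍ , refl))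
  Y≡PQ : Y ≡ (1+i ^ᵍ 2) *ᵍ P *ᵍ Q
  Y≡PQ = trans (cong ((1+i ^ᵍ 2) *ᵍ_) (sym P*Q≡)) (sym (*ᵍ-assoc (1+i ^ᵍ 2) P Q))
  from-unit : (∃ λ t → A₀ ≡ iPow (t + + 1) × B₀ ≡ iPow (t + + 1) *ᵍ (negOnePow t *ᵍ iᵍ)) → Parametrisation X Y Z
  from-unit (t , A₀≡u , B₀≡uv) =
    t , P , Q , InG-prodPow ps ps₁ distinct primes ps₁-primes , InG-prodPow ps ps₂ distinct primes ps₂-primes ,
    coprime-parametrisation {X} {Y} u v (1+i ^ᵍ 2) P Q coprime X≡ Y≡PQ , X≡ , Y≡PQ , Z≡
    where
    u = iPow (t + + 1)
    v = negOnePow t *ᵍ iᵍ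
    X≡&Z≡ : X ≡ u *ᵍ (P *ᵍ P -ᵍ v *ᵍ (Q *ᵍ Q)) × X +ᵍ (D +ᵍ D) ≡ u *ᵍ (P *ᵍ P +ᵍ v *ᵍ (Q *ᵍ Q))
    X≡&Z≡ = sum-and-difference {X} {D} u v P Q (trans A≡ (cong (_*ᵍ (P *ᵍ P)) A₀≡u))
                                               (trans B≡ (cong (_*ᵍ (Q *ᵍ Q)) B₀≡uv))
    X≡ = proj₁ X≡&Z≡
    Z≡ = proj₂ X≡&Z≡

theorem4p11 : (X Y Z : GZ) → InOI X → InOI Z
    → (∃ λ W → InG W × Y ≡ (1+i ^ᵍ 2) *ᵍ W)
    → X *ᵍ X +ᵍ iᵍ *ᵍ (Y *ᵍ Y) ≡ Z *ᵍ Z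
    → Coprimeᵍ X Y
    → X *ᵍ Y *ᵍ Z ≢ 0ᵍ
    → ∃ λ (t : ℤ) → ∃ λ P → ∃ λ Q → InG P × InG Q × Coprimeᵍ P Q
        × X ≡ iPow (t + + 1) *ᵍ (P *ᵍ P -ᵍ negOnePow t *ᵍ iᵍ *ᵍ (Q *ᵍ Q))
        × Y ≡ (1+i ^ᵍ 2) *ᵍ P *ᵍ Q
        × Z ≡ iPow (t + + 1) *ᵍ (P *ᵍ P +ᵍ negOnePow t *ᵍ iᵍ *ᵍ (Q *ᵍ Q))
theorem4p11 X Y Z X∈OI Z∈OI (W , (a₁ , ps , distinct , primes , refl) , Y≡) pyth coprime _ =
  parametrise (InOI-difference-even X Z X∈OI Z∈OI)
  where
  F = (1+i , a₁) ∷ ps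
  F-primes : All (IsPrimeᵍ ∘ proj₁) F
  F-primes = 1+i-isPrime All.∷ All.map (irreducible⇒prime _ ∘ proj₁) primes
  parametrise : (∃ λ D → Z ≡ X +ᵍ (D +ᵍ D)) → Parametrisation X Y Z
  parametrise (D , Z≡X+2D) = split⇒parametrisation a₁ ps distinct primes coprime Z≡X+2D Y≡
    (split-squares F F-primes (-ᵍ iᵍ) (pythagorean⇒product {X} D (prodPow F) Z≡X+2D Y≡ pyth) common-divisor-unit)
    where
    common-divisor-unit : ∀ d → d ∣ᵍ (X +ᵍ D) → d ∣ᵍ D → d ∣ᵍ prodPow F → IsUnit d
    common-divisor-unit d d∣X+D d∣D d∣W = coprime d
      (subst (d ∣ᵍ_) (//-rightDividesʳ D X) (∣ᵍ-- d (X +ᵍ D) D d∣X+D d∣D))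
      (subst (d ∣ᵍ_) (sym Y≡) (∣ᵍ-*ˡ d (prodPow F) (1+i ^ᵍ 2) d∣W))
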